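{- For all integers $a\ge0$, $m\ge2$ and $n\ge1$, \[ S_m^{(a)}(n)=(m-2)!\left[\psi_m^{(a)}(n)-\sum_{i=2}^{m-1}a_{mi}S_i^{(a)}(n)\right], \] where the sum is empty (zero) when $m=2$.
   Context: For integers $m\ge0$, $n\ge1$: $S_m^{(0)}(n)=n^m$ and $S_m^{(a)}(n)=\sum_{i=1}^n S_m^{(a-1)}(i)$ for $a\ge1$. For an integer $m\ge 2$, $\psi_m$ is the polynomial in $n$ defined by $\psi_m(n)=n+(m-1)(n-1)\binom{n+m-2}{m-1}=n+\frac{(n-1)n(n+1)\cdots(n+m-2)}{(m-2)!}$, with coefficients $a_{ml}$ given by $\psi_m(n)=\sum_{l=0}^m a_{ml}n^l$; further $\psi_m^{(0)}(n)=\psi_m(n)$ and $\psi_m^{(a)}(n)=\sum_{i=1}^n\psi_m^{(a-1)}(i)$ for $a\ge1$, $n\ge1$. -}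

module Defs where

open import Data.Nat as ℕ using (ℕ; zero; suc; _∸_)
open import Data.Nat using (_!)
open import Data.Nat.Properties using (_!≢0)
open import Data.Integer as ℤ using (ℤ)
open import Data.List using (List; []; _∷_)
open import Data.Rational using (ℚ; 0ℚ; 1ℚ; _+_; _*_; _-_; _÷_)
import Data.Rational as Q
open import Relation.Nullary using (yes; no)

ℕ→ℚ : ℕ → ℚ
ℕ→ℚ n = (ℤ.+ n) Q./ 1

sumFrom1 : (ℕ → ℕ) → ℕ → ℕ
sumFrom1 f zero    = 0
sumFrom1 f (suc n) = sumFrom1 f n ℕ.+ f (suc n)

S : ℕ → ℕ → ℕ → ℕ
S m zero    n = n ℕ.^ m
S m (suc a) n = sumFrom1 (S m a) n

-- Polynomials over ℚ as coefficient lists (constant term first).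
Poly : Set
Poly = List ℚ

padd : Poly → Poly → Poly
padd []       q        = q
padd p        []       = p
padd (x ∷ p)  (y ∷ q)  = (x + y) ∷ padd p q

pscale : ℚ → Poly → Poly
pscale c []      = []
pscale c (x ∷ p) = (c * x) ∷ pscale c p

pmul : Poly → Poly → Poly
pmul []      q = []
pmul (x ∷ p) q = padd (pscale x q) (0ℚ ∷ pmul p q)

peval : Poly → ℚ → ℚ
peval []      x = 0ℚ
peval (c ∷ p) x = c + x * peval p x

coeff : Poly → ℕ → ℚ
coeff []      l       = 0ℚ
coeff (c ∷ p) zero    = c
coeff (c ∷ p) (suc l) = coeff p l

-- (n-1) n (n+1) ... (n+k-2) : product of (X + j) for j = -1, 0, ..., k-2  (k factors)
risingFrom-1 : ℕ → Poly
risingFrom-1 zero    = 1ℚ ∷ []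
risingFrom-1 (suc k) = pmul (risingFrom-1 k) (((ℤ.+ k ℤ.- ℤ.+ 1) Q./ 1) ∷ 1ℚ ∷ [])

psiPoly : ℕ → Poly
psiPoly m = padd (0ℚ ∷ 1ℚ ∷ [])
                 (pscale ((ℤ.+ 1) Q./ ((m ∸ 2) !)) (risingFrom-1 m))
  where instance _ = (m ∸ 2) !≢0

a : ℕ → ℕ → ℚ
a m l = coeff (psiPoly m) l

sumFrom1ℚ : (ℕ → ℚ) → ℕ → ℚ
sumFrom1ℚ f zero    = 0ℚ
sumFrom1ℚ f (suc n) = sumFrom1ℚ f n + f (suc n)

ψ : ℕ → ℕ → ℕ → ℚ
ψ m zero    n = peval (psiPoly m) (ℕ→ℚ n)
ψ m (suc k) n = sumFrom1ℚ (ψ m k) n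

-- Σ_{i=lo}^{hi} f i  (zero if hi < lo)
sumRange : ℕ → ℕ → (ℕ → ℚ) → ℚ
sumRange lo zero    f = 0ℚ
sumRange lo (suc h) f with lo ℕ.≤? suc h
... | yes _ = sumRange lo h f + f (suc h)
... | no  _ = 0ℚ

{-# OPTIONS --safe #-}
-- The product (n-1)n(n+1)⋯(n+m-2) has no constant term and linear coefficient
-- -(m-2)!, so after division by (m-2)! it cancels the summand n of ψ_m; hence
-- ψ_m(n) = Σ_{i=2}^m a_{mi} n^i with leading coefficient a_{mm} = 1/(m-2)!.
-- Iterated summation is linear and turns n^i into S_i^{(a)}(n), so
-- ψ_m^{(a)}(n) = Σ_{i=2}^m a_{mi} S_i^{(a)}(n); isolating the term i = m gives
-- the identity.
module Submission where

open import Defs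
open import Data.Nat using (ℕ; _≤_; _∸_; _!)
open import Data.Rational using (ℚ; _*_; _-_)
open import Relation.Binary.PropositionalEquality using (_≡_)

open import Data.Nat as ℕ using (zero; suc; s≤s; z≤n; _<_; NonZero)
import Data.Nat.Properties as ℕ
import Data.Integer as ℤ
import Data.Integer.Properties as ℤ
open import Data.Rational using (0ℚ; 1ℚ; _+_; -_; toℚᵘ)
import Data.Rational as ℚ
open import Data.Rational.Properties
open import Data.Rational.Unnormalised as ℚᵘ using (mkℚᵘ) renaming (_≃_ to _≃ᵘ_)
import Data.Rational.Unnormalised.Properties as ℚᵘ
open import Data.Rational.Solver using (module +-*-Solver)
open import Data.Fin using (Fin; toℕ)
open import Data.Fin.Properties using (toℕ-inject₁; toℕ-fromℕ)
open import Data.List using ([]; _∷_)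
open import Data.Empty using (⊥-elim)
open import Relation.Nullary using (yes; no)
open import Relation.Binary.PropositionalEquality
  using (refl; sym; trans; cong; cong₂; module ≡-Reasoning)
open import Algebra.Bundles using (CommutativeRing)
open import Algebra.Properties.Semiring.Sum (CommutativeRing.semiring +-*-commutativeRing)
  using (sum-syntax; sum-replicate-zero; sum-cong-≗; *-distribˡ-sum; ∑-distrib-+; sum-init-last)
open import Algebra.Properties.Semiring.Exp (CommutativeRing.semiring +-*-commutativeRing)
  using (_^_)
open +-*-Solver

toℚᵘ-ℕ→ℚ : ∀ n → toℚᵘ (ℕ→ℚ n) ≃ᵘ mkℚᵘ (ℤ.+ n) 0
toℚᵘ-ℕ→ℚ n = toℚᵘ-fromℚᵘ (mkℚᵘ (ℤ.+ n) 0)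

ℕ→ℚ-+ : ∀ m n → ℕ→ℚ (m ℕ.+ n) ≡ ℕ→ℚ m + ℕ→ℚ n
ℕ→ℚ-+ m n = toℚᵘ-injective (begin-equality
  toℚᵘ (ℕ→ℚ (m ℕ.+ n))                ≃⟨ toℚᵘ-ℕ→ℚ (m ℕ.+ n) ⟩
  mkℚᵘ (ℤ.+ (m ℕ.+ n)) 0               ≃⟨ ℚᵘ.≃-reflexive (cong (λ i → mkℚᵘ i 0) numerator) ⟩
  mkℚᵘ (ℤ.+ m) 0 ℚᵘ.+ mkℚᵘ (ℤ.+ n) 0  ≃⟨ ℚᵘ.+-cong (toℚᵘ-ℕ→ℚ m) (toℚᵘ-ℕ→ℚ n) ⟨
  toℚᵘ (ℕ→ℚ m) ℚᵘ.+ toℚᵘ (ℕ→ℚ n)      ≃⟨ toℚᵘ-homo-+ (ℕ→ℚ m) (ℕ→ℚ n) ⟨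
  toℚᵘ (ℕ→ℚ m + ℕ→ℚ n)                ∎)
  where
  open ℚᵘ.≤-Reasoning
  numerator : ℤ.+ (m ℕ.+ n) ≡ ℤ.+ m ℤ.* ℤ.+ 1 ℤ.+ ℤ.+ n ℤ.* ℤ.+ 1
  numerator = trans (ℤ.pos-+ m n)
    (sym (cong₂ ℤ._+_ (ℤ.*-identityʳ (ℤ.+ m)) (ℤ.*-identityʳ (ℤ.+ n))))

ℕ→ℚ-* : ∀ m n → ℕ→ℚ (m ℕ.* n) ≡ ℕ→ℚ m * ℕ→ℚ n
ℕ→ℚ-* m n = toℚᵘ-injective (begin-equality
  toℚᵘ (ℕ→ℚ (m ℕ.* n))                ≃⟨ toℚᵘ-ℕ→ℚ (m ℕ.* n) ⟩
  mkℚᵘ (ℤ.+ (m ℕ.* n)) 0               ≃⟨ ℚᵘ.≃-reflexive (cong (λ i → mkℚᵘ i 0) (ℤ.pos-* m n)) ⟩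
  mkℚᵘ (ℤ.+ m) 0 ℚᵘ.* mkℚᵘ (ℤ.+ n) 0  ≃⟨ ℚᵘ.*-cong (toℚᵘ-ℕ→ℚ m) (toℚᵘ-ℕ→ℚ n) ⟨
  toℚᵘ (ℕ→ℚ m) ℚᵘ.* toℚᵘ (ℕ→ℚ n)      ≃⟨ toℚᵘ-homo-* (ℕ→ℚ m) (ℕ→ℚ n) ⟨
  toℚᵘ (ℕ→ℚ m * ℕ→ℚ n)                ∎)
  where open ℚᵘ.≤-Reasoning

1/n*n≡1 : ∀ n .{{_ : NonZero n}} → (ℤ.+ 1 ℚ./ n) * ℕ→ℚ n ≡ 1ℚ
1/n*n≡1 n@(suc e) = toℚᵘ-injective (begin-equality
  toℚᵘ ((ℤ.+ 1 ℚ./ n) * ℕ→ℚ n)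
    ≃⟨ toℚᵘ-homo-* (ℤ.+ 1 ℚ./ n) (ℕ→ℚ n) ⟩
  toℚᵘ (ℤ.+ 1 ℚ./ n) ℚᵘ.* toℚᵘ (ℕ→ℚ n)
    ≃⟨ ℚᵘ.*-cong (toℚᵘ-fromℚᵘ (mkℚᵘ (ℤ.+ 1) e)) (toℚᵘ-ℕ→ℚ n) ⟩
  ℚᵘ.1/ mkℚᵘ (ℤ.+ n) 0 ℚᵘ.* mkℚᵘ (ℤ.+ n) 0
    ≃⟨ ℚᵘ.*-inverseˡ (mkℚᵘ (ℤ.+ n) 0) ⟩
  ℚᵘ.1ℚᵘ
    ∎)
  where open ℚᵘ.≤-Reasoning

open ≡-Reasoning

ℕ→ℚ-^ : ∀ n i → ℕ→ℚ (n ℕ.^ i) ≡ ℕ→ℚ n ^ i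
ℕ→ℚ-^ n zero    = refl
ℕ→ℚ-^ n (suc i) = trans (ℕ→ℚ-* n (n ℕ.^ i)) (cong (ℕ→ℚ n *_) (ℕ→ℚ-^ n i))

ℕ→ℚ-sumFrom1 : ∀ f n → ℕ→ℚ (sumFrom1 f n) ≡ sumFrom1ℚ (λ i → ℕ→ℚ (f i)) n
ℕ→ℚ-sumFrom1 f zero    = refl
ℕ→ℚ-sumFrom1 f (suc n) =
  trans (ℕ→ℚ-+ (sumFrom1 f n) (f (suc n))) (cong (_+ ℕ→ℚ (f (suc n))) (ℕ→ℚ-sumFrom1 f n))

sumFrom1ℚ-cong : ∀ {f g} → (∀ i → f i ≡ g i) → ∀ n → sumFrom1ℚ f n ≡ sumFrom1ℚ g n
sumFrom1ℚ-cong f≗g zero    = refl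
sumFrom1ℚ-cong f≗g (suc n) = cong₂ _+_ (sumFrom1ℚ-cong f≗g n) (f≗g (suc n))

*-distribˡ-sumFrom1ℚ : ∀ c f n → c * sumFrom1ℚ f n ≡ sumFrom1ℚ (λ i → c * f i) n
*-distribˡ-sumFrom1ℚ c f zero    = *-zeroʳ c
*-distribˡ-sumFrom1ℚ c f (suc n) =
  trans (*-distribˡ-+ c (sumFrom1ℚ f n) (f (suc n)))
        (cong (_+ c * f (suc n)) (*-distribˡ-sumFrom1ℚ c f n))

sumFrom1ℚ-∑ : ∀ {N} (F : Fin N → ℕ → ℚ) n →
  sumFrom1ℚ (λ t → ∑[ i < N ] F i t) n ≡ ∑[ i < N ] sumFrom1ℚ (F i) n
sumFrom1ℚ-∑ {N} F zero    = sym (sum-replicate-zero N)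
sumFrom1ℚ-∑ {N} F (suc n) =
  trans (cong (_+ ∑[ i < N ] F i (suc n)) (sumFrom1ℚ-∑ F n))
        (sym (∑-distrib-+ (λ i → sumFrom1ℚ (F i) n) (λ i → F i (suc n))))

∑-init-last : ∀ n (f : ℕ → ℚ) → ∑[ i < suc n ] f (toℕ i) ≡ ∑[ i < n ] f (toℕ i) + f n
∑-init-last n f = trans (sum-init-last {n} (λ i → f (toℕ i)))
  (cong₂ _+_ (sum-cong-≗ {n} (λ i → cong f (toℕ-inject₁ i))) (cong f (toℕ-fromℕ n)))

sumRange-2-∑ : ∀ n f → sumRange 2 (suc n) f ≡ ∑[ i < n ] f (2 ℕ.+ toℕ i)
sumRange-2-∑ zero    f = refl
sumRange-2-∑ (suc n) f with 2 ℕ.≤? 2 ℕ.+ n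
... | yes _ = trans (cong (_+ f (2 ℕ.+ n)) (sumRange-2-∑ n f))
                    (sym (∑-init-last n (λ i → f (2 ℕ.+ i))))
... | no 2≰ = ⊥-elim (2≰ (ℕ.m≤m+n 2 n))

coeff-padd : ∀ p q i → coeff (padd p q) i ≡ coeff p i + coeff q i
coeff-padd []      q       i       = sym (+-identityˡ (coeff q i))
coeff-padd (x ∷ p) []      i       = sym (+-identityʳ (coeff (x ∷ p) i))
coeff-padd (x ∷ p) (y ∷ q) zero    = refl
coeff-padd (x ∷ p) (y ∷ q) (suc i) = coeff-padd p q i

coeff-pscale : ∀ c p i → coeff (pscale c p) i ≡ c * coeff p i
coeff-pscale c []      i       = sym (*-zeroʳ c)
coeff-pscale c (x ∷ p) zero    = refl
coeff-pscale c (x ∷ p) (suc i) = coeff-pscale c p i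

coeff-pmul-linear-zero : ∀ p b c → coeff (pmul p (b ∷ c ∷ [])) 0 ≡ b * coeff p 0
coeff-pmul-linear-zero []      b c = sym (*-zeroʳ b)
coeff-pmul-linear-zero (x ∷ p) b c = trans (+-identityʳ (x * b)) (*-comm x b)

coeff-pmul-linear-suc : ∀ p b c i →
  coeff (pmul p (b ∷ c ∷ [])) (suc i) ≡ c * coeff p i + b * coeff p (suc i)
coeff-pmul-linear-suc []      b c i =
  sym (trans (cong₂ _+_ (*-zeroʳ c) (*-zeroʳ b)) (+-identityʳ 0ℚ))
coeff-pmul-linear-suc (x ∷ p) b c zero = begin
  coeff (padd (x * b ∷ x * c ∷ []) (0ℚ ∷ pmul p (b ∷ c ∷ []))) 1
    ≡⟨ coeff-padd (x * b ∷ x * c ∷ []) (0ℚ ∷ pmul p (b ∷ c ∷ [])) 1 ⟩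
  x * c + coeff (pmul p (b ∷ c ∷ [])) 0
    ≡⟨ cong₂ _+_ (*-comm x c) (coeff-pmul-linear-zero p b c) ⟩
  c * x + b * coeff p 0
    ∎
coeff-pmul-linear-suc (x ∷ p) b c (suc i) = begin
  coeff (padd (x * b ∷ x * c ∷ []) (0ℚ ∷ pmul p (b ∷ c ∷ []))) (2 ℕ.+ i)
    ≡⟨ coeff-padd (x * b ∷ x * c ∷ []) (0ℚ ∷ pmul p (b ∷ c ∷ [])) (2 ℕ.+ i) ⟩
  0ℚ + coeff (pmul p (b ∷ c ∷ [])) (suc i)
    ≡⟨ +-identityˡ _ ⟩
  coeff (pmul p (b ∷ c ∷ [])) (suc i)
    ≡⟨ coeff-pmul-linear-suc p b c i ⟩
  c * coeff p i + b * coeff p (suc i)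
    ∎

peval-∑ : ∀ p x N → (∀ i → N ≤ i → coeff p i ≡ 0ℚ) →
  peval p x ≡ ∑[ i < N ] (coeff p (toℕ i) * x ^ toℕ i)
peval-∑ []      x N       _ = begin
  0ℚ                           ≡⟨ sum-replicate-zero N ⟨
  ∑[ i < N ] 0ℚ                ≡⟨ sum-cong-≗ {N} (λ i → *-zeroˡ (x ^ toℕ i)) ⟨
  ∑[ i < N ] (0ℚ * x ^ toℕ i)  ∎
peval-∑ (c ∷ p) x zero    high = begin
  c + x * peval p x
    ≡⟨ cong₂ (λ u v → u + x * v) (high 0 z≤n) (peval-∑ p x 0 (λ i _ → high (suc i) z≤n)) ⟩
  0ℚ + x * 0ℚ
    ≡⟨ trans (+-identityˡ (x * 0ℚ)) (*-zeroʳ x) ⟩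
  0ℚ
    ∎
peval-∑ (c ∷ p) x (suc N) high = begin
  c + x * peval p x
    ≡⟨ cong (λ v → c + x * v) (peval-∑ p x N (λ i N≤i → high (suc i) (s≤s N≤i))) ⟩
  c + x * ∑[ i < N ] (coeff p (toℕ i) * x ^ toℕ i)
    ≡⟨ cong₂ _+_ (sym (*-identityʳ c)) (*-distribˡ-sum {N} x (λ i → coeff p (toℕ i) * x ^ toℕ i)) ⟩
  c * 1ℚ + ∑[ i < N ] (x * (coeff p (toℕ i) * x ^ toℕ i))
    ≡⟨ cong ((c * 1ℚ) +_) (sum-cong-≗ {N} (λ i → x*[c*y]≡c*[x*y] x (coeff p (toℕ i)) (x ^ toℕ i))) ⟩
  c * 1ℚ + ∑[ i < N ] (coeff p (toℕ i) * (x * x ^ toℕ i))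
    ∎
  where
  x*[c*y]≡c*[x*y] : ∀ x c y → x * (c * y) ≡ c * (x * y)
  x*[c*y]≡c*[x*y] = solve 3 (λ x c y → x :* (c :* y) := c :* (x :* y)) refl

factor-offset : ℕ → ℚ
factor-offset k = (ℤ.+ k ℤ.- ℤ.+ 1) ℚ./ 1

coeff-risingFrom-1-suc : ∀ k i → coeff (risingFrom-1 (suc k)) (suc i) ≡
  coeff (risingFrom-1 k) i + factor-offset k * coeff (risingFrom-1 k) (suc i)
coeff-risingFrom-1-suc k i =
  trans (coeff-pmul-linear-suc (risingFrom-1 k) (factor-offset k) 1ℚ i)
        (cong (_+ factor-offset k * coeff (risingFrom-1 k) (suc i)) (*-identityˡ (coeff (risingFrom-1 k) i)))

coeff-risingFrom-1-high : ∀ k i → k < i → coeff (risingFrom-1 k) i ≡ 0ℚ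
coeff-risingFrom-1-high zero    (suc i) _         = refl
coeff-risingFrom-1-high (suc k) (suc i) (s≤s k<i) = begin
  coeff (risingFrom-1 (suc k)) (suc i)
    ≡⟨ coeff-risingFrom-1-suc k i ⟩
  coeff (risingFrom-1 k) i + b * coeff (risingFrom-1 k) (suc i)
    ≡⟨ cong₂ (λ u v → u + b * v) (coeff-risingFrom-1-high k i k<i)
                                 (coeff-risingFrom-1-high k (suc i) (ℕ.m<n⇒m<1+n k<i)) ⟩
  0ℚ + b * 0ℚ
    ≡⟨ trans (+-identityˡ (b * 0ℚ)) (*-zeroʳ b) ⟩
  0ℚ
    ∎
  where b = factor-offset k

coeff-risingFrom-1-top : ∀ k → coeff (risingFrom-1 k) k ≡ 1ℚ
coeff-risingFrom-1-top zero    = refl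
coeff-risingFrom-1-top (suc k) = begin
  coeff (risingFrom-1 (suc k)) (suc k)
    ≡⟨ coeff-risingFrom-1-suc k k ⟩
  coeff (risingFrom-1 k) k + b * coeff (risingFrom-1 k) (suc k)
    ≡⟨ cong₂ (λ u v → u + b * v) (coeff-risingFrom-1-top k)
                                 (coeff-risingFrom-1-high k (suc k) (ℕ.n<1+n k)) ⟩
  1ℚ + b * 0ℚ
    ≡⟨ trans (cong (1ℚ +_) (*-zeroʳ b)) (+-identityʳ 1ℚ) ⟩
  1ℚ
    ∎
  where b = factor-offset k

coeff-risingFrom-1-zero : ∀ j → coeff (risingFrom-1 (2 ℕ.+ j)) 0 ≡ 0ℚ
coeff-risingFrom-1-zero zero    =
  trans (coeff-pmul-linear-zero (risingFrom-1 1) 0ℚ 1ℚ) (*-zeroˡ (coeff (risingFrom-1 1) 0))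
coeff-risingFrom-1-zero (suc j) =
  trans (coeff-pmul-linear-zero (risingFrom-1 (2 ℕ.+ j)) (ℕ→ℚ (suc j)) 1ℚ)
        (trans (cong (ℕ→ℚ (suc j) *_) (coeff-risingFrom-1-zero j)) (*-zeroʳ (ℕ→ℚ (suc j))))

coeff-risingFrom-1-one : ∀ j → coeff (risingFrom-1 (2 ℕ.+ j)) 1 ≡ - ℕ→ℚ (j !)
coeff-risingFrom-1-one zero    = refl
coeff-risingFrom-1-one (suc j) = begin
  coeff (risingFrom-1 (3 ℕ.+ j)) 1
    ≡⟨ coeff-risingFrom-1-suc (2 ℕ.+ j) 0 ⟩
  coeff (risingFrom-1 (2 ℕ.+ j)) 0 + ℕ→ℚ (suc j) * coeff (risingFrom-1 (2 ℕ.+ j)) 1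
    ≡⟨ cong₂ (λ u v → u + ℕ→ℚ (suc j) * v) (coeff-risingFrom-1-zero j) (coeff-risingFrom-1-one j) ⟩
  0ℚ + ℕ→ℚ (suc j) * - ℕ→ℚ (j !)
    ≡⟨ 0+x*-y≡-[x*y] (ℕ→ℚ (suc j)) (ℕ→ℚ (j !)) ⟩
  - (ℕ→ℚ (suc j) * ℕ→ℚ (j !))
    ≡⟨ cong -_ (ℕ→ℚ-* (suc j) (j !)) ⟨
  - ℕ→ℚ (suc j !)
    ∎
  where
  0+x*-y≡-[x*y] : ∀ x y → 0ℚ + x * - y ≡ - (x * y)
  0+x*-y≡-[x*y] = solve 2 (λ x y → con 0ℚ :+ x :* (:- y) := :- (x :* y)) refl

1/[_!] : ℕ → ℚ
1/[ j !] = (ℤ.+ 1 ℚ./ j !) {{j ℕ.!≢0}}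

a-coeff : ∀ j i →
  a (2 ℕ.+ j) i ≡ coeff (0ℚ ∷ 1ℚ ∷ []) i + 1/[ j !] * coeff (risingFrom-1 (2 ℕ.+ j)) i
a-coeff j i = trans (coeff-padd (0ℚ ∷ 1ℚ ∷ []) (pscale 1/[ j !] (risingFrom-1 (2 ℕ.+ j))) i)
  (cong (coeff (0ℚ ∷ 1ℚ ∷ []) i +_) (coeff-pscale 1/[ j !] (risingFrom-1 (2 ℕ.+ j)) i))

a-vanishes-with-risingFrom-1 : ∀ j i → coeff (0ℚ ∷ 1ℚ ∷ []) i ≡ 0ℚ →
  coeff (risingFrom-1 (2 ℕ.+ j)) i ≡ 0ℚ → a (2 ℕ.+ j) i ≡ 0ℚ
a-vanishes-with-risingFrom-1 j i linear≡0 rising≡0 = begin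
  a (2 ℕ.+ j) i
    ≡⟨ a-coeff j i ⟩
  coeff (0ℚ ∷ 1ℚ ∷ []) i + 1/[ j !] * coeff (risingFrom-1 (2 ℕ.+ j)) i
    ≡⟨ cong₂ (λ u v → u + 1/[ j !] * v) linear≡0 rising≡0 ⟩
  0ℚ + 1/[ j !] * 0ℚ
    ≡⟨ trans (+-identityˡ _) (*-zeroʳ 1/[ j !]) ⟩
  0ℚ
    ∎

a-zero : ∀ j → a (2 ℕ.+ j) 0 ≡ 0ℚ
a-zero j = a-vanishes-with-risingFrom-1 j 0 refl (coeff-risingFrom-1-zero j)

a-high : ∀ j i → 3 ℕ.+ j ≤ i → a (2 ℕ.+ j) i ≡ 0ℚ
a-high j i@(suc (suc _)) 3+j≤i@(s≤s (s≤s _)) =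
  a-vanishes-with-risingFrom-1 j i refl (coeff-risingFrom-1-high (2 ℕ.+ j) i 3+j≤i)

a-one : ∀ j → a (2 ℕ.+ j) 1 ≡ 0ℚ
a-one j = begin
  a (2 ℕ.+ j) 1
    ≡⟨ a-coeff j 1 ⟩
  1ℚ + 1/[ j !] * coeff (risingFrom-1 (2 ℕ.+ j)) 1
    ≡⟨ cong (λ v → 1ℚ + 1/[ j !] * v) (coeff-risingFrom-1-one j) ⟩
  1ℚ + 1/[ j !] * - ℕ→ℚ (j !)
    ≡⟨ 1+x*-y≡1-x*y 1/[ j !] (ℕ→ℚ (j !)) ⟩
  1ℚ - 1/[ j !] * ℕ→ℚ (j !)
    ≡⟨ cong (λ v → 1ℚ - v) (1/n*n≡1 (j !) {{j ℕ.!≢0}}) ⟩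
  1ℚ - 1ℚ
    ≡⟨ +-inverseʳ 1ℚ ⟩
  0ℚ
    ∎
  where
  1+x*-y≡1-x*y : ∀ x y → 1ℚ + x * - y ≡ 1ℚ - x * y
  1+x*-y≡1-x*y = solve 2 (λ x y → con 1ℚ :+ x :* (:- y) := con 1ℚ :- x :* y) refl

a-top*[m∸2]!≡1 : ∀ j → a (2 ℕ.+ j) (2 ℕ.+ j) * ℕ→ℚ (j !) ≡ 1ℚ
a-top*[m∸2]!≡1 j = begin
  a (2 ℕ.+ j) (2 ℕ.+ j) * ℕ→ℚ (j !)
    ≡⟨ cong (_* ℕ→ℚ (j !)) (a-coeff j (2 ℕ.+ j)) ⟩
  (0ℚ + 1/[ j !] * coeff (risingFrom-1 (2 ℕ.+ j)) (2 ℕ.+ j)) * ℕ→ℚ (j !)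
    ≡⟨ cong (λ v → (0ℚ + 1/[ j !] * v) * ℕ→ℚ (j !)) (coeff-risingFrom-1-top (2 ℕ.+ j)) ⟩
  (0ℚ + 1/[ j !] * 1ℚ) * ℕ→ℚ (j !)
    ≡⟨ cong (_* ℕ→ℚ (j !)) (trans (+-identityˡ _) (*-identityʳ 1/[ j !])) ⟩
  1/[ j !] * ℕ→ℚ (j !)
    ≡⟨ 1/n*n≡1 (j !) {{j ℕ.!≢0}} ⟩
  1ℚ
    ∎

ψ-∑ : ∀ m N → (∀ i → N ≤ i → a m i ≡ 0ℚ) →
  ∀ k n → ψ m k n ≡ ∑[ i < N ] (a m (toℕ i) * ℕ→ℚ (S (toℕ i) k n))
ψ-∑ m N high zero    n = trans (peval-∑ (psiPoly m) (ℕ→ℚ n) N high)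
  (sum-cong-≗ {N} (λ i → cong (a m (toℕ i) *_) (sym (ℕ→ℚ-^ n (toℕ i)))))
ψ-∑ m N high (suc k) n = begin
  sumFrom1ℚ (ψ m k) n
    ≡⟨ sumFrom1ℚ-cong (ψ-∑ m N high k) n ⟩
  sumFrom1ℚ (λ t → ∑[ i < N ] (aᵢ i * Sᵢ i t)) n
    ≡⟨ sumFrom1ℚ-∑ {N} (λ i t → aᵢ i * Sᵢ i t) n ⟩
  ∑[ i < N ] sumFrom1ℚ (λ t → aᵢ i * Sᵢ i t) n
    ≡⟨ sum-cong-≗ {N} (λ i → sym (*-distribˡ-sumFrom1ℚ (aᵢ i) (Sᵢ i) n)) ⟩
  ∑[ i < N ] (aᵢ i * sumFrom1ℚ (Sᵢ i) n)
    ≡⟨ sum-cong-≗ {N} (λ i → cong (aᵢ i *_) (sym (ℕ→ℚ-sumFrom1 (S (toℕ i) k) n))) ⟩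
  ∑[ i < N ] (aᵢ i * ℕ→ℚ (S (toℕ i) (suc k) n))
    ∎
  where
  aᵢ : Fin N → ℚ
  aᵢ i = a m (toℕ i)
  Sᵢ : Fin N → ℕ → ℚ
  Sᵢ i t = ℕ→ℚ (S (toℕ i) k t)

ψ-split : ∀ j k n → let m = 2 ℕ.+ j; g = λ i → a m i * ℕ→ℚ (S i k n) in
  ψ m k n ≡ sumRange 2 (suc j) g + g m
ψ-split j k n = begin
  ψ m k n                          ≡⟨ ψ-∑ m (suc m) (a-high j) k n ⟩
  g 0 + (g 1 + rest)               ≡⟨ cong₂ (λ u v → u + (v + rest)) (g-vanishes (a-zero j))
                                                                      (g-vanishes (a-one j)) ⟩
  0ℚ + (0ℚ + rest)                 ≡⟨ trans (+-identityˡ _) (+-identityˡ rest) ⟩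
  rest                             ≡⟨ ∑-init-last j (λ i → g (2 ℕ.+ i)) ⟩
  ∑[ i < j ] g (2 ℕ.+ toℕ i) + g m ≡⟨ cong (_+ g m) (sumRange-2-∑ j g) ⟨
  sumRange 2 (suc j) g + g m       ∎
  where
  m = 2 ℕ.+ j
  g : ℕ → ℚ
  g i = a m i * ℕ→ℚ (S i k n)
  rest : ℚ
  rest = ∑[ i < suc j ] g (2 ℕ.+ toℕ i)
  g-vanishes : ∀ {i} → a m i ≡ 0ℚ → g i ≡ 0ℚ
  g-vanishes {i} aᵢ≡0 = trans (cong (_* ℕ→ℚ (S i k n)) aᵢ≡0) (*-zeroˡ (ℕ→ℚ (S i k n)))

fact8 : ∀ (k m n : ℕ) → 2 ≤ m → 1 ≤ n →
    ℕ→ℚ (S m k n) ≡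
      ℕ→ℚ ((m ∸ 2) !) * (ψ m k n - sumRange 2 (m ∸ 1) (λ i → a m i * ℕ→ℚ (S i k n)))
-- The identity holds for n = 0 as well.
fact8 k (suc (suc j)) n (s≤s (s≤s _)) _ = sym (begin
  ℕ→ℚ (j !) * (ψ m k n - Σ)           ≡⟨ cong (λ v → ℕ→ℚ (j !) * (v - Σ)) (ψ-split j k n) ⟩
  ℕ→ℚ (j !) * ((Σ + a m m * Sₘ) - Σ)  ≡⟨ f*[[s+c*x]-s]≡[c*f]*x (ℕ→ℚ (j !)) Σ (a m m) Sₘ ⟩
  (a m m * ℕ→ℚ (j !)) * Sₘ            ≡⟨ cong (_* Sₘ) (a-top*[m∸2]!≡1 j) ⟩
  1ℚ * Sₘ                             ≡⟨ *-identityˡ Sₘ ⟩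
  Sₘ                                  ∎)
  where
  m = 2 ℕ.+ j
  Σ = sumRange 2 (suc j) (λ i → a m i * ℕ→ℚ (S i k n))
  Sₘ = ℕ→ℚ (S m k n)
  f*[[s+c*x]-s]≡[c*f]*x : ∀ f s c x → f * ((s + c * x) - s) ≡ (c * f) * x
  f*[[s+c*x]-s]≡[c*f]*x = solve 4 (λ f s c x → f :* ((s :+ c :* x) :- s) := (c :* f) :* x) refl
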